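{- Let $A,B$ be $t$-element subsets of $[n]$ with $B\le A$ and let $\gamma\in[n]\setminus A$. Put $A'=A\cup\{\gamma\}$, let $q$ be the least index, $1\le q\le t+1$, such that $\tilde b_q\not\le\tilde a'_q$ (with $\tilde b_{t+1}:=\infty$), put $a':=\tilde a'_q$ and $B':=B\cup\{a'\}$. Then: (1) $\gamma\le a'$; (2) $B'\le A'$; (3) $a'$ has the same level in $A'$ and in $B'$; (4) if an element $\alpha$ is at the same level $j$ in both $A$ and $B$ (i.e. $\tilde a_j=\alpha=\tilde b_j$) and $\gamma<\alpha$, then $a'<\alpha$ and $\alpha$ is at level $j+1$ in both $A'$ and $B'$; (5) any element at the same level in $A$ and $B$ is at the same level in $A'$ and $B'$.
   Context: For a finite subset $E\subseteq[n]$, $\tilde e_1<\tilde e_2<\cdots$ denote its elements in increasing order; an element $e$ is at level $k$ in $E$ if $e=\tilde e_k$. For $t$-element subsets, $E\le F$ means $\tilde e_k\le\tilde f_k$ for all $k$. -}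

module Defs where

open import Data.Nat using (ℕ; zero; suc; _≤_; _<_)
open import Data.List using (List; []; _∷_; length)
open import Data.List.Relation.Unary.All using (All)
open import Data.List.Relation.Unary.Linked using (Linked)
open import Data.Product using (_×_)
open import Relation.Binary.PropositionalEquality using (_≡_)

-- A finite subset of ℕ is represented by the list of its elements in
-- strictly increasing order  ẽ₁ < ẽ₂ < ⋯ .
Sorted : List ℕ → Set
Sorted = Linked _<_

IsSubset : ℕ → ℕ → List ℕ → Set
IsSubset n t E = Sorted E × All (λ x → 1 ≤ x × x ≤ n) E × length E ≡ t

-- Level k E e : the element e is at level k in E, i.e. e = ẽ_k (1-based).
data Level : ℕ → List ℕ → ℕ → Set where
  here  : ∀ {x xs} → Level 1 (x ∷ xs) x
  there : ∀ {k x xs e} → Level k xs e → Level (suc k) (x ∷ xs) e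

_≤ˢ_ : List ℕ → List ℕ → Set
E ≤ˢ F = (length E ≡ length F) × (∀ k x y → Level k E x → Level k F y → x ≤ y)

{-# OPTIONS --safe #-}
-- In a sorted list E, e is at level k iff e ∈ E and k = 1 + rank E e, where rank E e counts the
-- elements of E below e, so the whole argument is about ranks. A sorted list with the members of E
-- and a new element z is a permutation of z ∷ E; its ranks are those of E, raised by one above z.
-- The choice of q says that, with r = rank A′ a′, B stays below A′ at every rank below r and
-- exceeds a′ at rank r. Hence a′ also has rank r in B (so a′ ∉ B and a′ keeps its level in B′),
-- and γ ≤ a′. Passing to A′ and B′ raises ranks by one exactly above γ and above a′ respectively;
-- as γ ≤ a′ the two shifts are compatible, giving B′ ≤ A′ and the preservation of common levels.
module Submission where

open import Defs
open import Data.Nat using (ℕ; zero; suc; _+_; _≤_; _<_; _≮_; s≤s; s≤s⁻¹; _<?_)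
open import Data.Nat.Properties
open import Data.List using (List; _∷_; length; filter)
open import Data.List.Properties
  using (length-filter; filter-notAll; filter-accept; filter-reject; filter-none)
open import Data.List.Membership.Propositional using (_∈_; _∉_)
open import Data.List.Membership.Propositional.Properties.WithK using (unique∧set⇒bag)
open import Data.List.Relation.Unary.Any as Any using (here; there)
open import Data.List.Relation.Unary.All as All using (All; _∷_)
open import Data.List.Relation.Unary.All.Properties using (¬Any⇒All¬)
open import Data.List.Relation.Unary.AllPairs as AllPairs using (_∷_)
open import Data.List.Relation.Unary.Linked as Linked using ()
open import Data.List.Relation.Unary.Linked.Properties using (Linked⇒AllPairs)
open import Data.List.Relation.Unary.Unique.Propositional using (Unique)
open import Data.List.Relation.Binary.BagAndSetEquality using (∼bag⇒↭)
open import Data.List.Relation.Binary.Permutation.Propositional using (_↭_)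
open import Data.List.Relation.Binary.Permutation.Propositional.Properties using (↭-length; filter-↭)
open import Data.List.Relation.Binary.Sublist.Propositional using (⊆-refl)
open import Data.List.Relation.Binary.Sublist.Propositional.Properties using (filter⁺; length-mono-≤)
open import Data.Product using (_×_; ∃-syntax; _,_)
open import Data.Sum using (_⊎_; inj₁; inj₂; [_,_])
open import Function.Bundles using (_⇔_; mk⇔; Equivalence)
open import Relation.Nullary using (¬_; yes; no; contradiction)
open import Relation.Binary.Definitions using (tri<; tri≈; tri>)
open import Relation.Binary.PropositionalEquality
  using (_≡_; _≢_; refl; sym; trans; cong; subst; subst₂; module ≡-Reasoning)

rank : List ℕ → ℕ → ℕ
rank E e = length (filter (_<? e) E)

rank-∷-< : ∀ {z E e} → z < e → rank (z ∷ E) e ≡ suc (rank E e)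
rank-∷-< z<e = cong length (filter-accept (_<? _) z<e)

rank-∷-≮ : ∀ {z E e} → z ≮ e → rank (z ∷ E) e ≡ rank E e
rank-∷-≮ z≮e = cong length (filter-reject (_<? _) z≮e)

rank≤length : ∀ E {e} → rank E e ≤ length E
rank≤length E = length-filter (_<? _) E

rank<length : ∀ {E e} → e ∈ E → rank E e < length E
rank<length {E} e∈E = filter-notAll (_<? _) E (Any.map (λ { refl → <-irrefl refl }) e∈E)

rank-mono-≤ : ∀ E {e e′} → e ≤ e′ → rank E e ≤ rank E e′
rank-mono-≤ E e≤e′ =
  length-mono-≤ (filter⁺ (_<? _) (_<? _) (λ { refl x<e → <-≤-trans x<e e≤e′ }) (⊆-refl {x = E}))

rank-mono-< : ∀ {E x y} → x ∈ E → x < y → rank E x < rank E y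
rank-mono-< {x ∷ E} (here refl) x<y
  rewrite rank-∷-≮ {x} {E} (<-irrefl refl) | rank-∷-< {x} {E} x<y = s≤s (rank-mono-≤ E (<⇒≤ x<y))
rank-mono-< {z ∷ E} {x} {y} (there x∈E) x<y with z <? x | z <? y
... | yes z<x | _       rewrite rank-∷-< {z} {E} z<x | rank-∷-< {z} {E} (<-trans z<x x<y)
                        = s≤s (rank-mono-< x∈E x<y)
... | no z≮x  | yes z<y rewrite rank-∷-≮ {z} {E} z≮x | rank-∷-< {z} {E} z<y
                        = m<n⇒m<1+n (rank-mono-< x∈E x<y)
... | no z≮x  | no z≮y  rewrite rank-∷-≮ {z} {E} z≮x | rank-∷-≮ {z} {E} z≮y
                        = rank-mono-< x∈E x<y

rank-cancel-< : ∀ E {x y} → rank E x < rank E y → x < y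
rank-cancel-< E lt = ≰⇒> λ y≤x → <⇒≱ lt (rank-mono-≤ E y≤x)

rank-injective : ∀ {E x y} → x ∈ E → y ∈ E → rank E x ≡ rank E y → x ≡ y
rank-injective x∈E y∈E eq with <-cmp _ _
... | tri< x<y _ _ = contradiction eq (<⇒≢ (rank-mono-< x∈E x<y))
... | tri≈ _ x≡y _ = x≡y
... | tri> _ _ y<x = contradiction eq (>⇒≢ (rank-mono-< y∈E y<x))

rank-↭ : ∀ {E F e} → E ↭ F → rank E e ≡ rank F e
rank-↭ E↭F = ↭-length (filter-↭ (_<? _) E↭F)

sorted⇒unique : ∀ {E} → Sorted E → Unique E
sorted⇒unique s = AllPairs.map <⇒≢ (Linked⇒AllPairs <-trans s)

head-least : ∀ {x xs} → Sorted (x ∷ xs) → All (x <_) xs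
head-least s with x<xs ∷ _ ← Linked⇒AllPairs <-trans s = x<xs

rank-head : ∀ {x xs} → Sorted (x ∷ xs) → rank (x ∷ xs) x ≡ 0
rank-head s = cong length (filter-none (_<? _) (<-irrefl refl ∷ All.map <⇒≯ (head-least s)))

level⇒∈ : ∀ {k E e} → Level k E e → e ∈ E
level⇒∈ here      = here refl
level⇒∈ (there l) = there (level⇒∈ l)

level⇒rank : ∀ {k E e} → Sorted E → Level k E e → k ≡ suc (rank E e)
level⇒rank s here = cong suc (sym (rank-head s))
level⇒rank {suc k} {x ∷ xs} {e} s (there l) = begin
  suc k                 ≡⟨ cong suc (level⇒rank (Linked.tail s) l) ⟩
  suc (suc (rank xs e)) ≡⟨ cong suc (sym (rank-∷-< (All.lookup (head-least s) (level⇒∈ l)))) ⟩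
  suc (rank (x ∷ xs) e) ∎
  where open ≡-Reasoning

∈⇒level : ∀ {k E e} → Sorted E → e ∈ E → suc (rank E e) ≡ k → Level k E e
∈⇒level s (here refl) refl rewrite rank-head s = here
∈⇒level {E = x ∷ xs} s (there e∈xs) refl
  rewrite rank-∷-< {x} {xs} (All.lookup (head-least s) e∈xs)
  = there (∈⇒level (Linked.tail s) e∈xs refl)

level-exists : ∀ E {k} → k < length E → ∃[ x ] Level (suc k) E x
level-exists (x ∷ E) {zero}  _         = x , here
level-exists (_ ∷ E) {suc k} (s≤s k<n) with y , l ← level-exists E k<n = y , there l

rank-surjective : ∀ {E r} → Sorted E → r < length E → ∃[ x ] (x ∈ E × rank E x ≡ r)
rank-surjective {E} s r<n with x , l ← level-exists E r<n =
  x , level⇒∈ l , suc-injective (sym (level⇒rank s l))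

same-level⇒same-rank : ∀ {k E F x y} → Sorted E → Sorted F →
                       Level k E x → Level k F y → rank E x ≡ rank F y
same-level⇒same-rank sE sF lx ly = suc-injective (trans (sym (level⇒rank sE lx)) (level⇒rank sF ly))

level-shift : ∀ d {k E F e} → Sorted E → Sorted F → Level k E e → e ∈ F →
              rank F e ≡ d + rank E e → Level (d + k) F e
level-shift d {k} {E} {F} {e} sE sF l e∈F rFe≡d+rEe = ∈⇒level sF e∈F (begin
  suc (rank F e)       ≡⟨ cong suc rFe≡d+rEe ⟩
  suc (d + rank E e)   ≡⟨ sym (+-suc d _) ⟩
  d + suc (rank E e)   ≡⟨ cong (d +_) (sym (level⇒rank sE l)) ⟩
  d + k                ∎)
  where open ≡-Reasoning

insertion↭ : ∀ {E E′ z} → Sorted E → Sorted E′ → z ∉ E →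
             (∀ x → x ∈ E′ ⇔ (x ∈ E ⊎ x ≡ z)) → E′ ↭ z ∷ E
insertion↭ {E} {E′} {z} sE sE′ z∉E E′≈ =
  ∼bag⇒↭ (unique∧set⇒bag (sorted⇒unique sE′) (¬Any⇒All¬ E z∉E ∷ sorted⇒unique sE) (mk⇔ to from))
  where
  to : ∀ {x} → x ∈ E′ → x ∈ z ∷ E
  to x∈E′ = [ there , here ] (Equivalence.to (E′≈ _) x∈E′)
  from : ∀ {x} → x ∈ z ∷ E → x ∈ E′
  from (here x≡z)  = Equivalence.from (E′≈ _) (inj₂ x≡z)
  from (there x∈E) = Equivalence.from (E′≈ _) (inj₁ x∈E)

-- The hypotheses of the proposition in terms of ranks, with q = 1 + rank A′ a′.
module Insertion
  {A B A′ B′ : List ℕ} {γ a′ : ℕ}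
  (sA : Sorted A) (sB : Sorted B) (sA′ : Sorted A′) (sB′ : Sorted B′)
  (|B|≡|A| : length B ≡ length A) (γ∉A : γ ∉ A)
  (A′≈A∪γ : ∀ x → x ∈ A′ ⇔ (x ∈ A ⊎ x ≡ γ))
  (B′≈B∪a′ : ∀ x → x ∈ B′ ⇔ (x ∈ B ⊎ x ≡ a′))
  (a′∈A′ : a′ ∈ A′)
  (B≤A : ∀ {x y} → x ∈ B → y ∈ A → rank B x ≡ rank A y → x ≤ y)
  (B≤A′-below-a′ : ∀ {x y} → x ∈ B → y ∈ A′ → rank B x ≡ rank A′ y →
                   rank A′ y < rank A′ a′ → x ≤ y)
  (a′<B-at-a′ : ∀ {x} → x ∈ B → rank B x ≡ rank A′ a′ → a′ < x)
  where

  private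
    A′↭γ∷A : A′ ↭ γ ∷ A
    A′↭γ∷A = insertion↭ sA sA′ γ∉A A′≈A∪γ

  rank-A′-above : ∀ {e} → γ < e → rank A′ e ≡ suc (rank A e)
  rank-A′-above γ<e = trans (rank-↭ A′↭γ∷A) (rank-∷-< γ<e)

  rank-A′-below : ∀ {e} → γ ≮ e → rank A′ e ≡ rank A e
  rank-A′-below γ≮e = trans (rank-↭ A′↭γ∷A) (rank-∷-≮ γ≮e)

  |A′|≡1+|A| : length A′ ≡ suc (length A)
  |A′|≡1+|A| = ↭-length A′↭γ∷A

  ∈A⇒∈A′ : ∀ {x} → x ∈ A → x ∈ A′
  ∈A⇒∈A′ x∈A = Equivalence.from (A′≈A∪γ _) (inj₁ x∈A)

  ∈A′⇒∈A : ∀ {x} → x ∈ A′ → x ≢ γ → x ∈ A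
  ∈A′⇒∈A x∈A′ x≢γ with Equivalence.to (A′≈A∪γ _) x∈A′
  ... | inj₁ x∈A = x∈A
  ... | inj₂ x≡γ = contradiction x≡γ x≢γ

  γ≤a′ : γ ≤ a′
  γ≤a′ = ≮⇒≥ λ a′<γ →
    let a′∈A         = ∈A′⇒∈A a′∈A′ (<⇒≢ a′<γ)
        x , x∈B , rx = rank-surjective sB (subst (rank A a′ <_) (sym |B|≡|A|) (rank<length a′∈A))
        rank-a′      = rank-A′-below (<⇒≯ a′<γ)
    in <⇒≱ (a′<B-at-a′ x∈B (trans rx (sym rank-a′))) (B≤A x∈B a′∈A rx)

  rank-A′-a′≤|B| : rank A′ a′ ≤ length B
  rank-A′-a′≤|B| = subst (rank A′ a′ ≤_) (sym |B|≡|A|)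
    (s≤s⁻¹ (subst (rank A′ a′ <_) |A′|≡1+|A| (rank<length a′∈A′)))

  rank-B-a′ : rank B a′ ≡ rank A′ a′
  rank-B-a′ = ≤-antisym (≮⇒≥ not-below) (≮⇒≥ not-above)
    where
    not-below : rank A′ a′ ≮ rank B a′
    not-below m<r =
      let x , x∈B , rx = rank-surjective sB (<-≤-trans m<r (rank≤length B))
      in <-asym (rank-cancel-< B (subst (_< rank B a′) (sym rx) m<r)) (a′<B-at-a′ x∈B rx)
    not-above : rank B a′ ≮ rank A′ a′
    not-above r<m =
      let x , x∈B , rx  = rank-surjective sB (<-≤-trans r<m rank-A′-a′≤|B|)
          y , y∈A′ , ry = rank-surjective sA′ (<-trans r<m (rank<length a′∈A′))
          ry<m          = subst (_< rank A′ a′) (sym ry) r<m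
          a′≤x          = ≮⇒≥ λ x<a′ → <-irrefl rx (rank-mono-< x∈B x<a′)
          x≤y           = B≤A′-below-a′ x∈B y∈A′ (trans rx (sym ry)) ry<m
      in <⇒≱ (rank-cancel-< A′ ry<m) (≤-trans a′≤x x≤y)

  a′∉B : a′ ∉ B
  a′∉B a′∈B = <-irrefl refl (a′<B-at-a′ a′∈B rank-B-a′)

  private
    B′↭a′∷B : B′ ↭ a′ ∷ B
    B′↭a′∷B = insertion↭ sB sB′ a′∉B B′≈B∪a′

  rank-B′-above : ∀ {e} → a′ < e → rank B′ e ≡ suc (rank B e)
  rank-B′-above a′<e = trans (rank-↭ B′↭a′∷B) (rank-∷-< a′<e)

  rank-B′-below : ∀ {e} → a′ ≮ e → rank B′ e ≡ rank B e
  rank-B′-below a′≮e = trans (rank-↭ B′↭a′∷B) (rank-∷-≮ a′≮e)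

  |B′|≡|A′| : length B′ ≡ length A′
  |B′|≡|A′| = trans (↭-length B′↭a′∷B) (trans (cong suc |B|≡|A|) (sym |A′|≡1+|A|))

  ∈B⇒∈B′ : ∀ {x} → x ∈ B → x ∈ B′
  ∈B⇒∈B′ x∈B = Equivalence.from (B′≈B∪a′ _) (inj₁ x∈B)

  a′∈B′ : a′ ∈ B′
  a′∈B′ = Equivalence.from (B′≈B∪a′ a′) (inj₂ refl)

  rank-B′-a′ : rank B′ a′ ≡ rank A′ a′
  rank-B′-a′ = trans (rank-B′-below (<-irrefl refl)) rank-B-a′

  B′≤A′-below-a′ : ∀ {x y} → x ∈ B → x < a′ → y ∈ A′ → rank B′ x ≡ rank A′ y → x ≤ y
  B′≤A′-below-a′ {x} {y} x∈B x<a′ y∈A′ rx≡ry =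
    B≤A′-below-a′ x∈B y∈A′ rBx≡ry (subst₂ _<_ rBx≡ry rank-B-a′ (rank-mono-< x∈B x<a′))
    where
    rBx≡ry : rank B x ≡ rank A′ y
    rBx≡ry = trans (sym (rank-B′-below (<⇒≯ x<a′))) rx≡ry

  B′≤A′-above-a′ : ∀ {x y} → x ∈ B → a′ < x → y ∈ A′ → rank B′ x ≡ rank A′ y → x ≤ y
  B′≤A′-above-a′ {x} {y} x∈B a′<x y∈A′ rx≡ry = B≤A x∈B y∈A (suc-injective 1+rBx≡1+rAy)
    where
    a′<y : a′ < y
    a′<y = rank-cancel-< A′ (begin-strict
      rank A′ a′     ≡⟨ sym rank-B-a′ ⟩
      rank B a′      ≤⟨ rank-mono-≤ B (<⇒≤ a′<x) ⟩
      rank B x       <⟨ n<1+n _ ⟩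
      suc (rank B x) ≡⟨ trans (sym (rank-B′-above a′<x)) rx≡ry ⟩
      rank A′ y      ∎)
      where open ≤-Reasoning
    γ<y : γ < y
    γ<y = ≤-<-trans γ≤a′ a′<y
    y∈A : y ∈ A
    y∈A = ∈A′⇒∈A y∈A′ (>⇒≢ γ<y)
    1+rBx≡1+rAy : suc (rank B x) ≡ suc (rank A y)
    1+rBx≡1+rAy = begin
      suc (rank B x) ≡⟨ sym (rank-B′-above a′<x) ⟩
      rank B′ x      ≡⟨ rx≡ry ⟩
      rank A′ y      ≡⟨ rank-A′-above γ<y ⟩
      suc (rank A y) ∎
      where open ≡-Reasoning

  B′≤A′ : ∀ {x y} → x ∈ B′ → y ∈ A′ → rank B′ x ≡ rank A′ y → x ≤ y
  B′≤A′ {x} x∈B′ y∈A′ rx≡ry with Equivalence.to (B′≈B∪a′ x) x∈B′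
  ... | inj₂ refl = ≤-reflexive (rank-injective a′∈A′ y∈A′ (trans (sym rank-B′-a′) rx≡ry))
  ... | inj₁ x∈B with <-cmp x a′
  ...   | tri< x<a′ _ _ = B′≤A′-below-a′ x∈B x<a′ y∈A′ rx≡ry
  ...   | tri≈ _ refl _ = contradiction x∈B a′∉B
  ...   | tri> _ _ a′<x = B′≤A′-above-a′ x∈B a′<x y∈A′ rx≡ry

  B′≤ˢA′ : B′ ≤ˢ A′
  B′≤ˢA′ = |B′|≡|A′| , λ _ _ _ lx ly →
    B′≤A′ (level⇒∈ lx) (level⇒∈ ly) (same-level⇒same-rank sB′ sA′ lx ly)

  a′-level-in-B′ : Level (suc (rank A′ a′)) B′ a′
  a′-level-in-B′ = ∈⇒level sB′ a′∈B′ (cong suc rank-B′-a′)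

  a′<common-above-γ : ∀ {α} → α ∈ A → α ∈ B → rank B α ≡ rank A α → γ < α → a′ < α
  a′<common-above-γ {α} α∈A α∈B rBα≡rAα γ<α = ≰⇒> λ α≤a′ →
    let rAα<rA′α      = subst (rank A α <_) (sym (rank-A′-above γ<α)) (n<1+n _)
        y , y∈A′ , ry = rank-surjective sA′ (<-trans rAα<rA′α (rank<length (∈A⇒∈A′ α∈A)))
        ry<rα         = subst (_< rank A′ α) (sym ry) rAα<rA′α
        α≤y           = B≤A′-below-a′ α∈B y∈A′ (trans rBα≡rAα (sym ry))
                          (<-≤-trans ry<rα (rank-mono-≤ A′ α≤a′))
    in <⇒≱ (rank-cancel-< A′ ry<rα) α≤y

  common-level-above-γ : ∀ j α → Level j A α → Level j B α → γ < α →
                         (a′ < α) × Level (suc j) A′ α × Level (suc j) B′ α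
  common-level-above-γ j α lA lB γ<α =
    a′<α ,
    level-shift 1 sA sA′ lA (∈A⇒∈A′ (level⇒∈ lA)) (rank-A′-above γ<α) ,
    level-shift 1 sB sB′ lB (∈B⇒∈B′ (level⇒∈ lB)) (rank-B′-above a′<α)
    where
    a′<α : a′ < α
    a′<α = a′<common-above-γ (level⇒∈ lA) (level⇒∈ lB) (same-level⇒same-rank sB sA lB lA) γ<α

  common-level-below-γ : ∀ {j α} → Level j A α → Level j B α → α < γ → Level j A′ α × Level j B′ α
  common-level-below-γ lA lB α<γ =
    level-shift 0 sA sA′ lA (∈A⇒∈A′ (level⇒∈ lA)) (rank-A′-below (<⇒≯ α<γ)) ,
    level-shift 0 sB sB′ lB (∈B⇒∈B′ (level⇒∈ lB)) (rank-B′-below (<⇒≯ (<-≤-trans α<γ γ≤a′)))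

  common-level : ∀ j α → Level j A α → Level j B α → ∃[ k ] (Level k A′ α × Level k B′ α)
  common-level j α lA lB with <-cmp γ α
  ... | tri< γ<α _ _ with _ , lA′ , lB′ ← common-level-above-γ j α lA lB γ<α = suc j , lA′ , lB′
  ... | tri≈ _ refl _ = contradiction (level⇒∈ lA) γ∉A
  ... | tri> _ _ α<γ = j , common-level-below-γ lA lB α<γ

proposition5p3 : (n t : ℕ) (A B : List ℕ) (γ : ℕ) →
    IsSubset n t A → IsSubset n t B → B ≤ˢ A →
    1 ≤ γ → γ ≤ n → γ ∉ A →
    (A′ : List ℕ) → Sorted A′ → (∀ x → (x ∈ A′) ⇔ (x ∈ A ⊎ x ≡ γ)) →
    (q a′ : ℕ) → 1 ≤ q → q ≤ suc t → Level q A′ a′ →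
    (∀ k x y → k < q → Level k B x → Level k A′ y → x ≤ y) →
    (∀ x → Level q B x → ¬ (x ≤ a′)) →
    (B′ : List ℕ) → Sorted B′ → (∀ x → (x ∈ B′) ⇔ (x ∈ B ⊎ x ≡ a′)) →
    (γ ≤ a′)
    × (B′ ≤ˢ A′)
    × (∃[ k ] (Level k A′ a′ × Level k B′ a′))
    × (∀ j α → Level j A α → Level j B α → γ < α →
         (a′ < α) × Level (suc j) A′ α × Level (suc j) B′ α)
    × (∀ j α → Level j A α → Level j B α →
         ∃[ k ] (Level k A′ α × Level k B′ α))
proposition5p3 n t A B γ (sA , _ , |A|≡t) (sB , _ , |B|≡t) (_ , B≤ˢA) _ _ γ∉A
               A′ sA′ A′≈A∪γ q a′ _ _ a′-at-q B≤A′-below-q a′≮B-at-q B′ sB′ B′≈B∪a′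
  with refl ← level⇒rank sA′ a′-at-q
  = γ≤a′ , B′≤ˢA′ , (_ , a′-at-q , a′-level-in-B′) , common-level-above-γ , common-level
  where
  open Insertion sA sB sA′ sB′ (trans |B|≡t (sym |A|≡t)) γ∉A A′≈A∪γ B′≈B∪a′ (level⇒∈ a′-at-q)
    (λ x∈B y∈A rx≡ry → B≤ˢA _ _ _ (∈⇒level sB x∈B refl) (∈⇒level sA y∈A (cong suc (sym rx≡ry))))
    (λ x∈B y∈A′ rx≡ry ry<m → B≤A′-below-q _ _ _ (s≤s (subst (_< _) (sym rx≡ry) ry<m))
                               (∈⇒level sB x∈B refl) (∈⇒level sA′ y∈A′ (cong suc (sym rx≡ry))))
    (λ x∈B rx≡m → ≰⇒> (a′≮B-at-q _ (∈⇒level sB x∈B (cong suc rx≡m))))
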